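{- Let $t\geq 1$ be an integer and let $G$ be a graph on $n$ vertices with $e(G)>\frac{(n-t-1)^2}{4}$ that contains an odd cycle. Let $C$ be a shortest odd cycle of $G$. If $n\geq 6(t+1)$, then $C$ has length at most $\frac{2n}{3}$.
   Context: All graphs are finite and simple; $e(G)$ denotes the number of edges of $G$. -}

module Defs where

open import Data.Nat using (ℕ; zero; suc; _+_; _*_; _≤_; _<_; _<ᵇ_)
open import Data.Product using (Σ; _×_)
open import Data.Bool using (Bool; true; false; _∧_; if_then_else_)
open import Data.Fin using (Fin; toℕ; fromℕ; inject₁) renaming (zero to fzero; suc to fsuc)
open import Function.Definitions using (Injective)
open import Relation.Binary.PropositionalEquality using (_≡_)

record Graph (n : ℕ) : Set where
  field
    adj     : Fin n → Fin n → Bool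
    sym     : ∀ i j → adj i j ≡ adj j i
    irrefl  : ∀ i → adj i i ≡ false
open Graph public

sumFin : (n : ℕ) → (Fin n → ℕ) → ℕ
sumFin zero    f = 0
sumFin (suc n) f = f fzero + sumFin n (λ i → f (fsuc i))

boolToℕ : Bool → ℕ
boolToℕ true  = 1
boolToℕ false = 0

edges : {n : ℕ} → Graph n → ℕ
edges {n} G = sumFin n (λ i → sumFin n (λ j →
  boolToℕ ((toℕ i <ᵇ toℕ j) ∧ adj G i j)))

Adj : {n : ℕ} → Graph n → Fin n → Fin n → Set
Adj G i j = adj G i j ≡ true

record Cycle {n : ℕ} (G : Graph n) : Set where
  field
    m        : ℕ
    long     : 3 ≤ suc m
    vert     : Fin (suc m) → Fin n
    distinct : Injective _≡_ _≡_ vert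
    step     : ∀ (i : Fin m) → Adj G (vert (inject₁ i)) (vert (fsuc i))
    close    : Adj G (vert (fromℕ m)) (vert fzero)
open Cycle public

cycleLength : {n : ℕ} {G : Graph n} → Cycle G → ℕ
cycleLength C = suc (m C)

Odd : ℕ → Set
Odd k = Σ ℕ (λ r → k ≡ suc (2 * r))

OddCycle : {n : ℕ} {G : Graph n} → Cycle G → Set
OddCycle C = Odd (cycleLength C)

ShortestOddCycle : {n : ℕ} (G : Graph n) → Cycle G → Set
ShortestOddCycle G C = OddCycle C × (∀ (D : Cycle G) → OddCycle D → cycleLength C ≤ cycleLength D)

module Submission where

-- In a shortest odd cycle C of length L ≥ 5 every vertex v has at most two neighbours:
-- three neighbours cut C into three arcs, one of them of odd length d ≤ L − 2, and closing
-- that arc through v gives an odd closed walk of length d + 2, which contains an odd cycle;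
-- minimality forces d = L − 2, so the other two arcs have length 1 and one of them closes
-- with v into a triangle. Hence, with r = n − L vertices off C, every vertex off C has
-- degree at most r + 2, and splitting the 2 e(G) ordered adjacent pairs (u, w) by whether
-- w lies on C gives 2 e(G) ≤ 2n + r (r + 2). If 3L > 2n then 3r < n, and for
-- n ≥ 6 (t + 1) with t ≥ 1 this gives 4 e(G) ≤ (n − t − 1)², against the density of G.

open import Data.Bool using (Bool; true; false; _∧_)
open import Data.Bool.Properties using (∧-zeroʳ; ∧-identityʳ)
open import Data.Empty using (⊥; ⊥-elim)
open import Data.Fin using (Fin; toℕ; _≟_; fromℕ; fromℕ<; inject₁)
  renaming (zero to fzero; suc to fsuc; _<_ to _<ᶠ_)
import Data.Fin.Properties as Finₚ
open import Data.Nat hiding (_≟_)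
open import Data.Nat.DivMod using (_mod_; %-distribˡ-+; m%n%n≡m%n; m<n⇒m%n≡m; [m+n]%n≡m%n; n%n≡0)
open import Data.Nat.Induction using (<-rec)
open import Data.Nat.Properties hiding (_≟_)
open import Data.Nat.Tactic.RingSolver using (solve-∀)
open import Data.Parity.Base as ℙ using (0ℙ; 1ℙ)
import Data.Parity.Properties as ℙ
open import Data.Product using (Σ; ∃₂; _×_; _,_; proj₁; proj₂)
open import Data.Sum using (_⊎_; inj₁; inj₂)
open import Function using (_∘_)
open import Function.Definitions using (Injective)
open import Relation.Binary.Definitions using (tri<; tri≈; tri>)
open import Relation.Binary.PropositionalEquality
open import Relation.Nullary using (¬_; Dec; yes; no; does)
open import Relation.Nullary.Decidable using (_×-dec_)
open import Algebra.Properties.Semiring.Sum +-*-semiring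
  using (sum; sum-syntax; sum-cong-≗; ∑-comm; ∑-distrib-+; *-distribˡ-sum; *-distribʳ-sum)

open import Defs renaming (sym to adj-sym)

sumFin≡sum : ∀ n (f : Fin n → ℕ) → sumFin n f ≡ sum f
sumFin≡sum zero    f = refl
sumFin≡sum (suc n) f = cong (f fzero +_) (sumFin≡sum n (f ∘ fsuc))

sum-mono-≤ : ∀ {n} {f g : Fin n → ℕ} → (∀ i → f i ≤ g i) → sum f ≤ sum g
sum-mono-≤ {zero}  f≤g = z≤n
sum-mono-≤ {suc n} f≤g = +-mono-≤ (f≤g fzero) (sum-mono-≤ (f≤g ∘ fsuc))

sum-const : ∀ n c → ∑[ i < n ] c ≡ n * c
sum-const zero    c = refl
sum-const (suc n) c = cong (c +_) (sum-const n c)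

δ : ∀ {n} → Fin n → Fin n → ℕ
δ x y = boolToℕ (does (x ≟ y))

sum-*δ : ∀ {n} (f : Fin n → ℕ) (x : Fin n) → ∑[ j < n ] (f j * δ x j) ≡ f x
sum-*δ {suc n} f fzero = begin
  f fzero * 1 + ∑[ j < n ] (f (fsuc j) * 0)  ≡⟨ cong₂ _+_ (*-identityʳ _) (sum-cong-≗ (*-zeroʳ ∘ f ∘ fsuc)) ⟩
  f fzero + ∑[ j < n ] 0                     ≡⟨ cong (f fzero +_) (trans (sum-const n 0) (*-zeroʳ n)) ⟩
  f fzero + 0                                ≡⟨ +-identityʳ _ ⟩
  f fzero                                    ∎
  where open ≡-Reasoning
sum-*δ {suc n} f (fsuc x) =
  trans (cong (_+ ∑[ j < n ] (f (fsuc j) * δ x j)) (*-zeroʳ (f fzero))) (sum-*δ (f ∘ fsuc) x)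

sum-δ : ∀ {n} (x : Fin n) → ∑[ j < n ] δ x j ≡ 1
sum-δ {n} x = trans (sum-cong-≗ {n} λ j → sym (*-identityˡ (δ x j))) (sum-*δ (λ _ → 1) x)

count : ℕ → (ℕ → Bool) → ℕ
count L b = ∑[ k < L ] boolToℕ (b (toℕ k))

count≡0 : ∀ L b → (∀ k → k < L → b k ≢ true) → count L b ≡ 0
count≡0 zero    b none = refl
count≡0 (suc L) b none with b 0 in b0
... | true  = ⊥-elim (none 0 z<s b0)
... | false = count≡0 L (b ∘ suc) λ k k<L → none (suc k) (s<s k<L)

count≤1 : ∀ L b → (∀ i j → i < j → j < L → b i ≡ true → b j ≢ true) → count L b ≤ 1
count≤1 zero    b noPair = z≤n
count≤1 (suc L) b noPair with b 0 in b0
... | true  = ≤-reflexive (cong suc (count≡0 L (b ∘ suc) λ k k<L → noPair 0 (suc k) z<s (s<s k<L) b0))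
... | false = count≤1 L (b ∘ suc) λ i j i<j j<L → noPair (suc i) (suc j) (s<s i<j) (s<s j<L)

count≤2 : ∀ L b →
          (∀ i j k → i < j → j < k → k < L → b i ≡ true → b j ≡ true → b k ≢ true) →
          count L b ≤ 2
count≤2 zero    b noTriple = z≤n
count≤2 (suc L) b noTriple with b 0 in b0
... | true  = s≤s (count≤1 L (b ∘ suc) λ j k j<k k<L →
                     noTriple 0 (suc j) (suc k) z<s (s<s j<k) (s<s k<L) b0)
... | false = count≤2 L (b ∘ suc) λ i j k i<j j<k k<L →
                noTriple (suc i) (suc j) (suc k) (s<s i<j) (s<s j<k) (s<s k<L)

Odd⇒parity : ∀ {k} → Odd k → parity k ≡ 1ℙ
Odd⇒parity (r , refl) = trans (ℙ.+-homo-+ 1 (2 * r)) (cong (1ℙ ℙ.+_) (ℙ.*-homo-* 2 r))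

parity⇒Odd : ∀ k → parity k ≡ 1ℙ → Odd k
parity⇒Odd 1             _   = 0 , refl
parity⇒Odd (suc (suc k)) odd with parity⇒Odd k odd
... | r , refl = suc r , cong suc (sym (*-suc 2 r))

parity-+-odd : ∀ a b → parity (a + b) ≡ 1ℙ → parity a ≡ 1ℙ ⊎ parity b ≡ 1ℙ
parity-+-odd a b odd with parity a in pa
... | 1ℙ = inj₁ refl
... | 0ℙ = inj₂ (trans (sym (trans (ℙ.+-homo-+ a b) (cong (ℙ._+ parity b) pa))) odd)

does⇒witness : ∀ {P : Set} (P? : Dec P) → does P? ≡ true → P
does⇒witness (yes p) _ = p

module _ {ℓ n : ℕ} (f : Fin ℓ → Fin n) where

  Collision : Set
  Collision = ∃₂ λ i j → i <ᶠ j × f i ≡ f j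

  collision? : Dec Collision
  collision? = Finₚ.any? λ i → Finₚ.any? λ j → (i Finₚ.<? j) ×-dec (f i ≟ f j)

  ¬collision⇒injective : ¬ Collision → Injective _≡_ _≡_ f
  ¬collision⇒injective none {i} {j} fi≡fj with Finₚ.<-cmp i j
  ... | tri< i<j _ _ = ⊥-elim (none (i , j , i<j , fi≡fj))
  ... | tri≈ _ i≡j _ = i≡j
  ... | tri> _ _ j<i = ⊥-elim (none (j , i , j<i , sym fi≡fj))

module Walks {n : ℕ} (G : Graph n) where

  Adj-irrefl : ∀ {v} → ¬ Adj G v v
  Adj-irrefl {v} v~v with trans (sym (irrefl G v)) v~v
  ... | ()

  Adj-sym : ∀ {v w} → Adj G v w → Adj G w v
  Adj-sym {v} {w} v~w = trans (adj-sym G w v) v~w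

  -- Only the positions 0, …, ℓ of at belong to the walk; the values beyond ℓ are junk.
  record Walk (x y : Fin n) (ℓ : ℕ) : Set where
    field
      at       : ℕ → Fin n
      at-start : at 0 ≡ x
      at-end   : at ℓ ≡ y
      adjacent : ∀ k → k < ℓ → Adj G (at k) (at (suc k))
  open Walk public

  private variable
    x y z x′ y′ : Fin n
    ℓ ℓ₁ ℓ₂ : ℕ

  castʷ : x ≡ x′ → y ≡ y′ → Walk x y ℓ → Walk x′ y′ ℓ
  castʷ refl refl W = W

  nilʷ : Walk x x 0
  nilʷ {x} = record { at = λ _ → x ; at-start = refl ; at-end = refl ; adjacent = λ _ () }

  consʷ : Adj G x y → Walk y z ℓ → Walk x z (suc ℓ)
  consʷ {x} {ℓ = ℓ} x~y W = record { at = at′ ; at-start = refl ; at-end = at-end W ; adjacent = adj′ }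
    where
    at′ : ℕ → Fin n
    at′ zero    = x
    at′ (suc k) = at W k
    adj′ : ∀ k → k < suc ℓ → Adj G (at′ k) (at′ (suc k))
    adj′ zero    _   = subst (Adj G x) (sym (at-start W)) x~y
    adj′ (suc k) k<ℓ = adjacent W k (s<s⁻¹ k<ℓ)

  edgeʷ : Adj G x y → Walk x y 1
  edgeʷ x~y = consʷ x~y nilʷ

  tailʷ : (W : Walk x y (suc ℓ)) → Walk (at W 1) y ℓ
  tailʷ W = record
    { at = at W ∘ suc ; at-start = refl ; at-end = at-end W
    ; adjacent = λ k k<ℓ → adjacent W (suc k) (s<s k<ℓ) }

  _++ʷ_ : Walk x y ℓ₁ → Walk y z ℓ₂ → Walk x z (ℓ₁ + ℓ₂)
  _++ʷ_ {ℓ₁ = zero}  P Q = castʷ (trans (sym (at-end P)) (at-start P)) refl Q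
  _++ʷ_ {ℓ₁ = suc _} P Q =
    consʷ (subst (λ w → Adj G w (at P 1)) (at-start P) (adjacent P 0 z<s)) (tailʷ P ++ʷ Q)

  subWalk : (W : Walk x y ℓ) (i d : ℕ) → i + d ≤ ℓ → Walk (at W i) (at W (i + d)) d
  subWalk W i d i+d≤ℓ = record
    { at = λ k → at W (i + k) ; at-start = cong (at W) (+-identityʳ i) ; at-end = refl
    ; adjacent = λ k k<d → subst (λ j → Adj G (at W (i + k)) (at W j)) (sym (+-suc i k))
                             (adjacent W (i + k) (≤-trans (+-monoʳ-< i k<d) i+d≤ℓ)) }

  loopAt : (W : Walk x y ℓ) {i j : ℕ} → i ≤ j → j ≤ ℓ → at W i ≡ at W j →
           Walk (at W i) (at W i) (j ∸ i)
  loopAt {ℓ = ℓ} W {i} {j} i≤j j≤ℓ wi≡wj =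
    castʷ refl (trans (cong (at W) (m+[n∸m]≡n i≤j)) (sym wi≡wj))
      (subWalk W i (j ∸ i) (subst (_≤ ℓ) (sym (m+[n∸m]≡n i≤j)) j≤ℓ))

  skipLoop : (W : Walk x y ℓ) {i j : ℕ} → i ≤ j → j ≤ ℓ → at W i ≡ at W j →
             Walk x y (i + (ℓ ∸ j))
  skipLoop {ℓ = ℓ} W {i} {j} i≤j j≤ℓ wi≡wj =
    castʷ (at-start W) (trans (cong (at W) (m+[n∸m]≡n j≤ℓ)) (at-end W))
      (subWalk W 0 i (≤-trans i≤j j≤ℓ)
        ++ʷ castʷ (sym wi≡wj) refl (subWalk W j (ℓ ∸ j) (≤-reflexive (m+[n∸m]≡n j≤ℓ))))

  vertices : Walk x y ℓ → Fin ℓ → Fin n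
  vertices W k = at W (toℕ k)

  closedWalk⇒cycle : (W : Walk x x ℓ) → 3 ≤ ℓ → Injective _≡_ _≡_ (vertices W) →
                     Σ (Cycle G) λ D → cycleLength D ≡ ℓ
  closedWalk⇒cycle {ℓ = suc m} W 3≤ℓ injective = D , refl
    where
    D : Cycle G
    D = record
      { m        = m
      ; long     = 3≤ℓ
      ; vert     = vertices W
      ; distinct = injective
      ; step     = λ i → subst (λ k → Adj G (at W k) (at W (suc (toℕ i)))) (sym (Finₚ.toℕ-inject₁ i))
                            (adjacent W (toℕ i) (m<n⇒m<1+n (Finₚ.toℕ<n i)))
      ; close    = subst₂ (λ k v → Adj G (at W k) v) (sym (Finₚ.toℕ-fromℕ m))
                            (trans (at-end W) (sym (at-start W))) (adjacent W m ≤-refl)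
      }

  oddClosedWalk-long : Walk x x ℓ → parity ℓ ≡ 1ℙ → 3 ≤ ℓ
  oddClosedWalk-long {ℓ = 1} W _ =
    ⊥-elim (Adj-irrefl (subst (Adj G (at W 0)) (trans (at-end W) (sym (at-start W))) (adjacent W 0 z<s)))
  oddClosedWalk-long {ℓ = suc (suc (suc _))} W _ = s≤s (s≤s (s≤s z≤n))

  ShorterOddClosedWalk : ℕ → Set
  ShorterOddClosedWalk ℓ = Σ ℕ λ ℓ′ → ℓ′ < ℓ × parity ℓ′ ≡ 1ℙ × Σ (Fin n) λ y → Walk y y ℓ′

  collision⇒shorterOddClosedWalk : (W : Walk x x ℓ) → parity ℓ ≡ 1ℙ → Collision (vertices W) →
                                   ShorterOddClosedWalk ℓ
  collision⇒shorterOddClosedWalk {ℓ = ℓ} W odd (i , j , i<j , wi≡wj) =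
    shorter (parity-+-odd (b ∸ a) (a + (ℓ ∸ b)) (subst (λ k → parity k ≡ 1ℙ) (sym lengths) odd))
    where
    a = toℕ i
    b = toℕ j
    b≤ℓ : b ≤ ℓ
    b≤ℓ = <⇒≤ (Finₚ.toℕ<n j)
    lengths : (b ∸ a) + (a + (ℓ ∸ b)) ≡ ℓ
    lengths = begin
      (b ∸ a) + (a + (ℓ ∸ b)) ≡⟨ +-assoc (b ∸ a) a (ℓ ∸ b) ⟨
      (b ∸ a + a) + (ℓ ∸ b)   ≡⟨ cong (_+ (ℓ ∸ b)) (m∸n+n≡m (<⇒≤ i<j)) ⟩
      b + (ℓ ∸ b)             ≡⟨ m+[n∸m]≡n b≤ℓ ⟩
      ℓ                       ∎
      where open ≡-Reasoning
    shorter : parity (b ∸ a) ≡ 1ℙ ⊎ parity (a + (ℓ ∸ b)) ≡ 1ℙ → ShorterOddClosedWalk ℓ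
    shorter (inj₁ odd₁) =
      _ , ≤-<-trans (m∸n≤m b a) (Finₚ.toℕ<n j) , odd₁ ,
      _ , loopAt W (<⇒≤ i<j) b≤ℓ wi≡wj
    shorter (inj₂ odd₂) =
      _ , subst (a + (ℓ ∸ b) <_) (m+[n∸m]≡n b≤ℓ) (+-monoˡ-< (ℓ ∸ b) i<j) , odd₂ ,
      _ , skipLoop W (<⇒≤ i<j) b≤ℓ wi≡wj

  OddCycleWithin : ℕ → Set
  OddCycleWithin ℓ = Σ (Cycle G) λ D → OddCycle D × cycleLength D ≤ ℓ

  -- A repeated vertex splits the walk into two shorter closed walks, one of them odd;
  -- a closed walk without repeated vertices is a cycle.
  oddClosedWalk⇒oddCycle : Walk x x ℓ → parity ℓ ≡ 1ℙ → OddCycleWithin ℓ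
  oddClosedWalk⇒oddCycle {ℓ = ℓ} = <-rec P shorten ℓ
    where
    P : ℕ → Set
    P ℓ = ∀ {x} → Walk x x ℓ → parity ℓ ≡ 1ℙ → OddCycleWithin ℓ

    shorten : ∀ ℓ → (∀ {ℓ′} → ℓ′ < ℓ → P ℓ′) → P ℓ
    shorten ℓ rec W odd with collision? (vertices W)
    ... | no none with closedWalk⇒cycle W (oddClosedWalk-long W odd) (¬collision⇒injective _ none)
    ...   | D , refl = D , parity⇒Odd (cycleLength D) odd , ≤-refl
    shorten ℓ rec W odd | yes collision
      with collision⇒shorterOddClosedWalk W odd collision
    ... | ℓ′ , ℓ′<ℓ , odd′ , _ , W′ with rec ℓ′<ℓ W′ odd′
    ...   | D , oddD , len≤ℓ′ = D , oddD , ≤-trans len≤ℓ′ (<⇒≤ ℓ′<ℓ)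

%≡⇒mod≡ : ∀ a b d .{{_ : NonZero d}} → a % d ≡ b % d → a mod d ≡ b mod d
%≡⇒mod≡ a b d a%d≡b%d = Finₚ.toℕ-injective
  (trans (Finₚ.toℕ-fromℕ< _) (trans a%d≡b%d (sym (Finₚ.toℕ-fromℕ< _))))

suc-% : ∀ k d .{{_ : NonZero d}} → suc k % d ≡ suc (k % d) % d
suc-% k d = begin
  (1 + k) % d                 ≡⟨ %-distribˡ-+ 1 k d ⟩
  (1 % d + k % d) % d         ≡⟨ cong (λ r → (1 % d + r) % d) (m%n%n≡m%n k d) ⟨
  (1 % d + k % d % d) % d     ≡⟨ %-distribˡ-+ 1 (k % d) d ⟨
  (1 + k % d) % d             ∎
  where open ≡-Reasoning

-- Closing an odd arc of length d of a shortest odd cycle of length L through a common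
-- neighbour of its ends gives an odd closed walk of length 2 + d, hence L ≤ 2 + d.
ShortOddGap : ℕ → ℕ → Set
ShortOddGap L d = parity d ≡ 1ℙ → L ≤ 2 + d

-- L ≤ 2 + x leaves y = z = 1, and the odd gap y = 1 would give L ≤ 3.
oddGap-impossible : ∀ {L} x y z → x + (y + z) ≡ L → 5 ≤ L → 1 ≤ y → 1 ≤ z →
                    L ≤ 2 + x → ShortOddGap L y → ⊥
oddGap-impossible x (suc zero) (suc z) refl 5≤L _ _ _ short-y = <⇒≱ 5≤L (m≤n⇒m≤1+n (short-y refl))
oddGap-impossible x (suc (suc y)) (suc z) refl _ _ _ L≤2+x _
  with +-cancelˡ-≤ x (suc (suc y) + suc z) 2 (subst (x + (suc (suc y) + suc z) ≤_) (+-comm 2 x) L≤2+x)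
... | s≤s (s≤s y+1+z≤0) = m+1+n≰m 0 (≤-trans (m≤n+m (suc z) y) y+1+z≤0)

threeGaps-impossible : ∀ {L} a b c → a + b + c ≡ L → 5 ≤ L → parity L ≡ 1ℙ →
                       1 ≤ a → 1 ≤ b → 1 ≤ c →
                       ShortOddGap L a → ShortOddGap L b → ShortOddGap L c → ⊥
threeGaps-impossible a b c refl 5≤L odd 1≤a 1≤b 1≤c short-a short-b short-c
  with parity-+-odd (a + b) c odd
... | inj₂ odd-c = oddGap-impossible c a b (+-comm c (a + b)) 5≤L 1≤a 1≤b (short-c odd-c) short-a
... | inj₁ odd-ab with parity-+-odd a b odd-ab
...   | inj₁ odd-a = oddGap-impossible a b c (sym (+-assoc a b c)) 5≤L 1≤b 1≤c (short-a odd-a) short-b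
...   | inj₂ odd-b = oddGap-impossible b a c (trans (sym (+-assoc b a c)) (cong (_+ c) (+-comm b a)))
                       5≤L 1≤a 1≤c (short-b odd-b) short-a

<ᵇ-exclusive : ∀ a b → a ≢ b → boolToℕ (a <ᵇ b) + boolToℕ (b <ᵇ a) ≡ 1
<ᵇ-exclusive zero    zero    a≢b = ⊥-elim (a≢b refl)
<ᵇ-exclusive zero    (suc b) _   = refl
<ᵇ-exclusive (suc a) zero    _   = refl
<ᵇ-exclusive (suc a) (suc b) a≢b = <ᵇ-exclusive a b (a≢b ∘ cong suc)

-- For the indicator s of a vertex set S, uncovered s = |V ∖ S|.
uncovered : ∀ {n} → (Fin n → ℕ) → ℕ
uncovered {n} s = ∑[ v < n ] (1 ∸ s v)

sum+uncovered : ∀ {n} (s : Fin n → ℕ) → (∀ v → s v ≤ 1) → sum s + uncovered s ≡ n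
sum+uncovered {n} s s≤1 = begin
  sum s + uncovered s        ≡⟨ ∑-distrib-+ s (λ v → 1 ∸ s v) ⟨
  ∑[ v < n ] (s v + (1 ∸ s v)) ≡⟨ sum-cong-≗ (λ v → m+[n∸m]≡n (s≤1 v)) ⟩
  ∑[ v < n ] 1               ≡⟨ sum-const n 1 ⟩
  n * 1                      ≡⟨ *-identityʳ n ⟩
  n                          ∎
  where open ≡-Reasoning

module _ {n : ℕ} (G : Graph n) where
  open Walks G

  A : Fin n → Fin n → ℕ
  A i j = boolToℕ (adj G i j)

  A-sym : ∀ i j → A i j ≡ A j i
  A-sym i j = cong boolToℕ (adj-sym G i j)

  A≤1 : ∀ i j → A i j ≤ 1
  A≤1 i j with adj G i j
  ... | true  = ≤-refl
  ... | false = z≤n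

  handshake : 2 * edges G ≡ ∑[ i < n ] ∑[ j < n ] A i j
  handshake = sym (begin
    ∑[ i < n ] ∑[ j < n ] A i j
      ≡⟨ sum-cong-≗ (λ i → sum-cong-≗ (split i)) ⟩
    ∑[ i < n ] ∑[ j < n ] (below i j + below j i)
      ≡⟨ sum-cong-≗ (λ i → ∑-distrib-+ (below i) (λ j → below j i)) ⟩
    ∑[ i < n ] (∑[ j < n ] below i j + ∑[ j < n ] below j i)
      ≡⟨ ∑-distrib-+ (λ i → ∑[ j < n ] below i j) _ ⟩
    e + ∑[ i < n ] ∑[ j < n ] below j i
      ≡⟨ cong (e +_) (∑-comm (λ i j → below j i)) ⟩
    e + e
      ≡⟨ cong (e +_) (+-identityʳ e) ⟨
    2 * e
      ≡⟨ cong (2 *_) edges≡e ⟨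
    2 * edges G
      ∎)
    where
    open ≡-Reasoning
    below : Fin n → Fin n → ℕ
    below i j = boolToℕ ((toℕ i <ᵇ toℕ j) ∧ adj G i j)
    e = ∑[ i < n ] ∑[ j < n ] below i j
    edges≡e : edges G ≡ e
    edges≡e = trans (sumFin≡sum n _) (sum-cong-≗ (λ i → sumFin≡sum n (below i)))
    split : ∀ i j → A i j ≡ below i j + below j i
    split i j rewrite adj-sym G j i with adj G i j in i~j
    ... | false rewrite ∧-zeroʳ (toℕ i <ᵇ toℕ j) | ∧-zeroʳ (toℕ j <ᵇ toℕ i) = refl
    ... | true  rewrite ∧-identityʳ (toℕ i <ᵇ toℕ j) | ∧-identityʳ (toℕ j <ᵇ toℕ i) =
      sym (<ᵇ-exclusive (toℕ i) (toℕ j) λ eq →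
             Adj-irrefl (subst (Adj G i) (sym (Finₚ.toℕ-injective eq)) i~j))

  module _ (s : Fin n → ℕ) (s≤1 : ∀ v → s v ≤ 1)
           (fewNeighbours : ∀ i → ∑[ j < n ] (A i j * s j) ≤ 2) where

    private
      t : Fin n → ℕ
      t v = 1 ∸ s v

      r : ℕ
      r = uncovered s

      A-split : ∀ i j → A i j ≡ A i j * s j + A i j * t j
      A-split i j = sym (begin
        A i j * s j + A i j * t j ≡⟨ *-distribˡ-+ (A i j) (s j) (t j) ⟨
        A i j * (s j + t j)       ≡⟨ cong (A i j *_) (m+[n∸m]≡n (s≤1 j)) ⟩
        A i j * 1                 ≡⟨ *-identityʳ (A i j) ⟩
        A i j                     ∎)
        where open ≡-Reasoning

      row-split : ∀ i → ∑[ j < n ] A i j ≡ ∑[ j < n ] (A i j * s j) + ∑[ j < n ] (A i j * t j)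
      row-split i = trans (sum-cong-≗ (A-split i)) (∑-distrib-+ (λ j → A i j * s j) (λ j → A i j * t j))

      degree≤ : ∀ i → ∑[ j < n ] A i j ≤ 2 + r
      degree≤ i = begin
        ∑[ j < n ] A i j                                      ≡⟨ row-split i ⟩
        ∑[ j < n ] (A i j * s j) + ∑[ j < n ] (A i j * t j)  ≤⟨ +-mono-≤ (fewNeighbours i) (sum-mono-≤ A*t≤t) ⟩
        2 + r                                                 ∎
        where
        open ≤-Reasoning
        A*t≤t : ∀ j → A i j * t j ≤ t j
        A*t≤t j = ≤-trans (*-monoˡ-≤ (t j) (A≤1 i j)) (≤-reflexive (*-identityˡ (t j)))

    edges-bound : 2 * edges G ≤ 2 * n + uncovered s * (2 + uncovered s)
    edges-bound = begin
      2 * edges G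
        ≡⟨ handshake ⟩
      ∑[ i < n ] ∑[ j < n ] A i j
        ≡⟨ sum-cong-≗ row-split ⟩
      ∑[ i < n ] (∑[ j < n ] (A i j * s j) + ∑[ j < n ] (A i j * t j))
        ≡⟨ ∑-distrib-+ (λ i → ∑[ j < n ] (A i j * s j)) (λ i → ∑[ j < n ] (A i j * t j)) ⟩
      ∑[ i < n ] ∑[ j < n ] (A i j * s j) + ∑[ i < n ] ∑[ j < n ] (A i j * t j)
        ≤⟨ +-mono-≤ onS offS ⟩
      2 * n + r * (2 + r)
        ∎
      where
      open ≤-Reasoning
      onS : ∑[ i < n ] ∑[ j < n ] (A i j * s j) ≤ 2 * n
      onS = begin
        ∑[ i < n ] ∑[ j < n ] (A i j * s j) ≤⟨ sum-mono-≤ fewNeighbours ⟩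
        ∑[ i < n ] 2                        ≡⟨ sum-const n 2 ⟩
        n * 2                               ≡⟨ *-comm n 2 ⟩
        2 * n                               ∎
      offS : ∑[ i < n ] ∑[ j < n ] (A i j * t j) ≤ r * (2 + r)
      offS = begin
        ∑[ i < n ] ∑[ j < n ] (A i j * t j)  ≡⟨ ∑-comm (λ i j → A i j * t j) ⟩
        ∑[ j < n ] ∑[ i < n ] (A i j * t j)  ≡⟨ sum-cong-≗ (λ j → sum-cong-≗ λ i → A*t≡t*A i j) ⟩
        ∑[ j < n ] ∑[ i < n ] (t j * A j i)  ≡⟨ sum-cong-≗ (λ j → *-distribˡ-sum (t j) (A j)) ⟨
        ∑[ j < n ] (t j * ∑[ i < n ] A j i)  ≤⟨ sum-mono-≤ (λ j → *-monoʳ-≤ (t j) (degree≤ j)) ⟩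
        ∑[ j < n ] (t j * (2 + r))           ≡⟨ *-distribʳ-sum (2 + r) t ⟨
        r * (2 + r)                          ∎
        where
        A*t≡t*A : ∀ i j → A i j * t j ≡ t j * A j i
        A*t≡t*A i j = trans (cong (_* t j) (A-sym i j)) (*-comm (A j i) (t j))

module _ {n : ℕ} {G : Graph n} (C : Cycle G) where
  open Walks G

  -- Positions along C are read modulo its length, so every stretch of vertMod is a walk.
  vertMod : ℕ → Fin n
  vertMod k = vert C (k mod cycleLength C)

  vertMod-periodic : ∀ k → vertMod (cycleLength C + k) ≡ vertMod k
  vertMod-periodic k = cong (vert C) (%≡⇒mod≡ (cycleLength C + k) k (cycleLength C)
    (trans (cong (_% cycleLength C) (+-comm (cycleLength C) k)) ([m+n]%n≡m%n k (cycleLength C))))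

  vert-adj-next : ∀ i → Adj G (vert C i) (vert C (suc (toℕ i) mod cycleLength C))
  vert-adj-next i with m≤n⇒m<n∨m≡n (Finₚ.toℕ≤pred[n] i)
  ... | inj₁ i<m = subst₂ (λ u v → Adj G (vert C u) (vert C v)) inject₁-i fsuc-i (step C i′)
    where
    i′ = fromℕ< i<m
    inject₁-i : inject₁ i′ ≡ i
    inject₁-i = Finₚ.toℕ-injective (trans (Finₚ.toℕ-inject₁ i′) (Finₚ.toℕ-fromℕ< i<m))
    fsuc-i : fsuc i′ ≡ suc (toℕ i) mod cycleLength C
    fsuc-i = Finₚ.toℕ-injective (begin
      suc (toℕ i′)                             ≡⟨ cong suc (Finₚ.toℕ-fromℕ< i<m) ⟩
      suc (toℕ i)                              ≡⟨ m<n⇒m%n≡m (s≤s i<m) ⟨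
      suc (toℕ i) % cycleLength C              ≡⟨ Finₚ.toℕ-fromℕ< _ ⟨
      toℕ (suc (toℕ i) mod cycleLength C)      ∎)
      where open ≡-Reasoning
  ... | inj₂ i≡m = subst₂ (λ u v → Adj G (vert C u) (vert C v)) last-i wrap (close C)
    where
    last-i : fromℕ (m C) ≡ i
    last-i = Finₚ.toℕ-injective (trans (Finₚ.toℕ-fromℕ (m C)) (sym i≡m))
    wrap : fzero ≡ suc (toℕ i) mod cycleLength C
    wrap = Finₚ.toℕ-injective (sym (begin
      toℕ (suc (toℕ i) mod cycleLength C)  ≡⟨ Finₚ.toℕ-fromℕ< _ ⟩
      suc (toℕ i) % cycleLength C          ≡⟨ cong (λ k → suc k % cycleLength C) i≡m ⟩
      cycleLength C % cycleLength C        ≡⟨ n%n≡0 (cycleLength C) ⟩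
      0                                    ∎))
      where open ≡-Reasoning

  vertMod-adj : ∀ k → Adj G (vertMod k) (vertMod (suc k))
  vertMod-adj k = subst (λ v → Adj G (vertMod k) (vert C v))
    (%≡⇒mod≡ (suc (toℕ (k mod cycleLength C))) (suc k) (cycleLength C)
      (trans (cong (λ r → suc r % cycleLength C) (Finₚ.toℕ-fromℕ< _)) (sym (suc-% k (cycleLength C)))))
    (vert-adj-next (k mod cycleLength C))

  vertMod-injective : ∀ {i j} → i < cycleLength C → j < cycleLength C → vertMod i ≡ vertMod j → i ≡ j
  vertMod-injective {i} {j} i<L j<L same = begin
    i                             ≡⟨ m<n⇒m%n≡m i<L ⟨
    i % cycleLength C             ≡⟨ Finₚ.toℕ-fromℕ< _ ⟨
    toℕ (i mod cycleLength C)     ≡⟨ cong toℕ (distinct C same) ⟩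
    toℕ (j mod cycleLength C)     ≡⟨ Finₚ.toℕ-fromℕ< _ ⟩
    j % cycleLength C             ≡⟨ m<n⇒m%n≡m j<L ⟩
    j                             ∎
    where open ≡-Reasoning

  arc : ∀ i d → Walk (vertMod i) (vertMod (i + d)) d
  arc i d = record
    { at = λ k → vertMod (i + k) ; at-start = cong vertMod (+-identityʳ i) ; at-end = refl
    ; adjacent = λ k _ → subst (λ j → Adj G (vertMod (i + k)) (vertMod j)) (sym (+-suc i k))
                           (vertMod-adj (i + k)) }

  -- The indicator of V(C), written as a count of positions so that sums weighted by it
  -- become sums along C.
  multiplicity : Fin n → ℕ
  multiplicity v = count (cycleLength C) (λ k → does (vertMod k ≟ v))

  multiplicity≤1 : ∀ v → multiplicity v ≤ 1
  multiplicity≤1 v = count≤1 (cycleLength C) _ λ i j i<j j<L i↦v j↦v →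
    <⇒≢ i<j (vertMod-injective (<-trans i<j j<L) j<L
      (trans (does⇒witness (_ ≟ v) i↦v) (sym (does⇒witness (_ ≟ v) j↦v))))

  sum-multiplicity : sum multiplicity ≡ cycleLength C
  sum-multiplicity = begin
    ∑[ v < n ] ∑[ k < L ] δ (x k) v       ≡⟨ ∑-comm (λ v k → δ (x k) v) ⟩
    ∑[ k < L ] ∑[ v < n ] δ (x k) v       ≡⟨ sum-cong-≗ (λ k → sum-δ (x k)) ⟩
    ∑[ k < L ] 1                          ≡⟨ sum-const L 1 ⟩
    L * 1                                 ≡⟨ *-identityʳ L ⟩
    L                                     ∎
    where
    open ≡-Reasoning
    L = cycleLength C
    x : Fin L → Fin n
    x k = vertMod (toℕ k)

  sum-A*multiplicity : ∀ i → ∑[ j < n ] (A G i j * multiplicity j) ≡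
                             count (cycleLength C) (λ k → adj G i (vertMod k))
  sum-A*multiplicity i = begin
    ∑[ j < n ] (A G i j * ∑[ k < L ] δ (x k) j)    ≡⟨ sum-cong-≗ (λ j → *-distribˡ-sum (A G i j) (λ k → δ (x k) j)) ⟩
    ∑[ j < n ] ∑[ k < L ] (A G i j * δ (x k) j)    ≡⟨ ∑-comm (λ j k → A G i j * δ (x k) j) ⟩
    ∑[ k < L ] ∑[ j < n ] (A G i j * δ (x k) j)    ≡⟨ sum-cong-≗ (λ k → sum-*δ (A G i) (x k)) ⟩
    ∑[ k < L ] A G i (x k)                         ∎
    where
    open ≡-Reasoning
    L = cycleLength C
    x : Fin L → Fin n
    x k = vertMod (toℕ k)

module _ {n : ℕ} {G : Graph n} (C : Cycle G) (shortest : ShortestOddCycle G C) where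
  open Walks G

  oddClosedWalk-≥ : ∀ {x ℓ} → Walk x x ℓ → parity ℓ ≡ 1ℙ → cycleLength C ≤ ℓ
  oddClosedWalk-≥ W odd with oddClosedWalk⇒oddCycle W odd
  ... | D , oddD , D≤ℓ = ≤-trans (proj₂ shortest D oddD) D≤ℓ

  oddArc-long : ∀ {v} i d → Adj G v (vertMod C i) → Adj G v (vertMod C (i + d)) →
                ShortOddGap (cycleLength C) d
  oddArc-long {v} i d v~i v~j = oddClosedWalk-≥
    (subst (Walk v v) (cong suc (+-comm d 1)) (consʷ v~i (arc C i d ++ʷ edgeʷ (Adj-sym v~j))))

  module _ (5≤L : 5 ≤ cycleLength C) where

    noThreeNeighboursAt : ∀ {v} p a b c → a + b + c ≡ cycleLength C → 1 ≤ a → 1 ≤ b → 1 ≤ c →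
      Adj G v (vertMod C p) → Adj G v (vertMod C (p + a)) → ¬ Adj G v (vertMod C (p + a + b))
    noThreeNeighboursAt {v} p a b c a+b+c≡L 1≤a 1≤b 1≤c v~p v~q v~r =
      threeGaps-impossible a b c a+b+c≡L 5≤L (Odd⇒parity (proj₁ shortest)) 1≤a 1≤b 1≤c
        (oddArc-long p a v~p v~q) (oddArc-long (p + a) b v~q v~r)
        (oddArc-long (p + a + b) c v~r (subst (Adj G v) around v~p))
      where
      around : vertMod C p ≡ vertMod C (p + a + b + c)
      around = begin
        vertMod C p                        ≡⟨ vertMod-periodic C p ⟨
        vertMod C (cycleLength C + p)      ≡⟨ cong (λ L → vertMod C (L + p)) a+b+c≡L ⟨
        vertMod C (a + b + c + p)          ≡⟨ cong (vertMod C) (reassoc a b c p) ⟩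
        vertMod C (p + a + b + c)          ∎
        where
        open ≡-Reasoning
        reassoc : ∀ a b c p → a + b + c + p ≡ p + a + b + c
        reassoc = solve-∀

    neighboursOnCycle≤2 : ∀ v → count (cycleLength C) (λ k → adj G v (vertMod C k)) ≤ 2
    neighboursOnCycle≤2 v = count≤2 (cycleLength C) _ noTriple
      where
      noTriple : ∀ i j k → i < j → j < k → k < cycleLength C →
                 Adj G v (vertMod C i) → Adj G v (vertMod C j) → ¬ Adj G v (vertMod C k)
      noTriple i j k i<j j<k k<L v~i v~j v~k
        with m≤n⇒∃[o]m+o≡n i<j | m≤n⇒∃[o]m+o≡n j<k | m≤n⇒∃[o]m+o≡n k<L
      ... | d₁ , refl | d₂ , refl | d₃ , k<L-offset =
        noThreeNeighboursAt i (suc d₁) (suc d₂) (suc (d₃ + i))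
          (trans (gaps i d₁ d₂ d₃) k<L-offset) (s≤s z≤n) (s≤s z≤n) (s≤s z≤n)
          v~i (subst (λ q → Adj G v (vertMod C q)) (second i d₁) v~j)
          (subst (λ q → Adj G v (vertMod C q)) (third i d₁ d₂) v~k)
        where
        gaps : ∀ i d₁ d₂ d₃ → suc d₁ + suc d₂ + suc (d₃ + i) ≡ suc (suc (suc i + d₁) + d₂) + d₃
        gaps = solve-∀
        second : ∀ i d₁ → suc i + d₁ ≡ i + suc d₁
        second = solve-∀
        third : ∀ i d₁ d₂ → suc (suc i + d₁) + d₂ ≡ i + suc d₁ + suc d₂
        third = solve-∀

-- Writing t = 1 + a and n = 6 (t + 1) + w, we get n ∸ t ∸ 1 = M, and slack a w is the
-- expansion of 9 M² − 48 N − 2 N², whose coefficients are all nonnegative.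
bound≤[n∸t∸1]² : ∀ t n r → 1 ≤ t → 6 * (t + 1) ≤ n → 3 * r < n →
                 2 * (2 * n + r * (2 + r)) ≤ (n ∸ t ∸ 1) ^ 2
bound≤[n∸t∸1]² (suc a) n r _ 6[t+1]≤n 3r<n with m≤n⇒∃[o]m+o≡n 6[t+1]≤n
... | w , refl = subst (λ M → 2 * (2 * N + r * (2 + r)) ≤ M ^ 2) (sym N∸t∸1) (*-cancelˡ-≤ 9 (begin
  9 * (2 * (2 * N + r * (2 + r)))                ≡⟨ expand N r ⟩
  36 * N + 12 * (3 * r) + 2 * (3 * r * (3 * r))  ≤⟨ +-mono-≤ (+-monoʳ-≤ (36 * N) (*-monoʳ-≤ 12 3r≤N))
                                                                (*-monoʳ-≤ 2 (*-mono-≤ 3r≤N 3r≤N)) ⟩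
  36 * N + 12 * N + 2 * (N * N)                  ≤⟨ m≤m+n _ _ ⟩
  36 * N + 12 * N + 2 * (N * N) + slack a w      ≡⟨ square a w ⟩
  9 * (M ^ 2)                                    ∎))
  where
  open ≤-Reasoning
  N = 6 * (suc a + 1) + w
  M = 5 * (suc a + 1) + w
  3r≤N : 3 * r ≤ N
  3r≤N = <⇒≤ 3r<n
  N∸t∸1 : N ∸ suc a ∸ 1 ≡ M
  N∸t∸1 = trans (∸-+-assoc N (suc a) 1) (trans (cong (_∸ (suc a + 1)) (split a w)) (m+n∸m≡n (suc a + 1) M))
    where
    split : ∀ a w → 6 * (suc a + 1) + w ≡ (suc a + 1) + (5 * (suc a + 1) + w)
    split = solve-∀
  expand : ∀ N r → 9 * (2 * (2 * N + r * (2 + r))) ≡ 36 * N + 12 * (3 * r) + 2 * (3 * r * (3 * r))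
  expand = solve-∀
  slack : ℕ → ℕ → ℕ
  slack a w = 36 + 324 * a + 153 * (a * a) + 84 * w + 66 * (a * w) + 7 * (w * w)
  square : ∀ a w → 36 * (6 * (suc a + 1) + w) + 12 * (6 * (suc a + 1) + w)
                     + 2 * ((6 * (suc a + 1) + w) * (6 * (suc a + 1) + w))
                     + (36 + 324 * a + 153 * (a * a) + 84 * w + 66 * (a * w) + 7 * (w * w))
                   ≡ 9 * ((5 * (suc a + 1) + w) * ((5 * (suc a + 1) + w) * 1))
  square = solve-∀

2n<3L⇒3r<n : ∀ L r {n} → L + r ≡ n → 2 * n < 3 * L → 3 * r < n
2n<3L⇒3r<n L r refl 2n<3L = +-cancelʳ-< (2 * (L + r)) (3 * r) (L + r) (begin-strict
  3 * r + 2 * (L + r)    <⟨ +-monoʳ-< (3 * r) 2n<3L ⟩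
  3 * r + 3 * L          ≡⟨ regroup L r ⟩
  (L + r) + 2 * (L + r)  ∎)
  where
  open ≤-Reasoning
  regroup : ∀ L r → 3 * r + 3 * L ≡ (L + r) + 2 * (L + r)
  regroup = solve-∀

fact2p2 : (t n : ℕ) → 1 ≤ t → (G : Graph n) → (n ∸ t ∸ 1) ^ 2 < 4 * edges G
    → (C : Cycle G) → ShortestOddCycle G C → 6 * (t + 1) ≤ n
    → 3 * cycleLength C ≤ 2 * n
fact2p2 t n 1≤t G dense C shortest 6[t+1]≤n with 3 * cycleLength C ≤? 2 * n
... | yes short = short
... | no long = ⊥-elim (<⇒≱ dense (begin
  4 * edges G                 ≡⟨ *-assoc 2 2 (edges G) ⟩
  2 * (2 * edges G)           ≤⟨ *-monoʳ-≤ 2 (edges-bound G s (multiplicity≤1 C) fewNeighbours) ⟩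
  2 * (2 * n + r * (2 + r))   ≤⟨ bound≤[n∸t∸1]² t n r 1≤t 6[t+1]≤n 3r<n ⟩
  (n ∸ t ∸ 1) ^ 2             ∎))
  where
  open ≤-Reasoning
  s = multiplicity C
  r = uncovered s
  2n<3L : 2 * n < 3 * cycleLength C
  2n<3L = ≰⇒> long
  L+r≡n : cycleLength C + r ≡ n
  L+r≡n = trans (cong (_+ r) (sym (sum-multiplicity C))) (sum+uncovered s (multiplicity≤1 C))
  3r<n : 3 * r < n
  3r<n = 2n<3L⇒3r<n (cycleLength C) r L+r≡n 2n<3L
  5≤L : 5 ≤ cycleLength C
  5≤L = *-cancelˡ-< 3 4 (cycleLength C) (begin-strict
    12                 ≤⟨ m≤m+n 12 12 ⟩
    2 * 12             ≤⟨ *-monoʳ-≤ 2 (≤-trans (*-monoʳ-≤ 6 (+-monoˡ-≤ 1 1≤t)) 6[t+1]≤n) ⟩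
    2 * n              <⟨ 2n<3L ⟩
    3 * cycleLength C  ∎)
  fewNeighbours : ∀ i → ∑[ j < n ] (A G i j * s j) ≤ 2
  fewNeighbours i = subst (_≤ 2) (sym (sum-A*multiplicity C i)) (neighboursOnCycle≤2 C shortest 5≤L i)
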